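{- Let $n \ge 5$, let $S$ be a set of transpositions generating $S_n$, let $T = T(S)$ be the transposition graph of $S$ and $L(T)$ its line graph, and let $G := \mathrm{Aut}(\mathrm{Cay}(S_n,S))$. Then the restriction map $G_e \to \mathrm{Aut}(L(T))$, $g \mapsto g|_S$, is surjective.
   Context: For a group $H$ and a subset $S \subseteq H$ with $1 \notin S$ and $S = S^{ -1}$, the Cayley graph $\mathrm{Cay}(H,S)$ is the simple undirected graph with vertex set $H$ and edges $\{h, sh\}$ for $h \in H$, $s \in S$. $G_e$ is the stabilizer in $G$ of the identity vertex $e$; its elements permute $S$, the neighborhood of $e$. The transposition graph $T(S)$ is the graph on $\{1,\ldots,n\}$ in which $i,j$ are adjacent iff $(i,j) \in S$; the vertex set of $L(T)$ is identified with $S$. -}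

module Defs where

open import Data.Nat using (ℕ)
open import Data.Fin using (Fin)
open import Data.Vec using (Vec; lookup; tabulate)
open import Data.Vec.Properties using (lookup∘tabulate)
open import Data.Bool using (Bool; T)
open import Data.Product using (Σ; ∃; ∃-syntax; _×_; _,_; proj₁)
open import Function using (_∘_; id)
open import Function.Bundles using (_↔_; Inverse; _⇔_)
open import Relation.Nullary using (¬_)
open import Relation.Binary.PropositionalEquality using (_≡_; _≢_; refl; trans; sym)
open import Data.Fin.Permutation.Components using (transpose)

-- Elements of the symmetric group S_n, i.e. permutations of {0,…,n-1}
-- (= Fin n), represented by their table of values; the (irrelevant)
-- injectivity proof makes propositional equality = equality of permutations.
record Sym (n : ℕ) : Set where
  constructor mkSym
  field
    vec  : Vec (Fin n) n
    .inj : ∀ i j → lookup vec i ≡ lookup vec j → i ≡ j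
open Sym public

app : ∀ {n} → Sym n → Fin n → Fin n
app σ = lookup (vec σ)

e : ∀ {n} → Sym n
e {n} = mkSym (tabulate id) (λ i j p → trans (sym (lookup∘tabulate id i)) (trans p (lookup∘tabulate id j)))

_·_ : ∀ {n} → Sym n → Sym n → Sym n
mkSym σ σi · mkSym τ τi = mkSym (tabulate (λ k → lookup σ (lookup τ k)))
  (λ i j p → τi i j (σi _ _ (trans (sym (lookup∘tabulate _ i)) (trans p (lookup∘tabulate _ j)))))

IsTranspositionOf : ∀ {n} → Sym n → Fin n → Fin n → Set
IsTranspositionOf σ i j = i ≢ j × (∀ k → app σ k ≡ transpose i j k)

IsTransposition : ∀ {n} → Sym n → Set
IsTransposition σ = ∃[ i ] ∃[ j ] IsTranspositionOf σ i j

Subset : ℕ → Set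
Subset n = Sym n → Bool

_∈_ : ∀ {n} → Sym n → Subset n → Set
σ ∈ S = T (S σ)

-- subgroup generated by S (S consists of involutions here, so closure
-- under left multiplication by elements of S starting from e suffices)
data Generated {n} (S : Subset n) : Sym n → Set where
  gen-e : Generated S e
  gen-· : ∀ {s σ} → s ∈ S → Generated S σ → Generated S (s · σ)

GeneratesSym : ∀ {n} → Subset n → Set
GeneratesSym S = ∀ σ → Generated S σ

CayAdj : ∀ {n} → Subset n → Sym n → Sym n → Set
CayAdj S h h′ = ∃[ s ] (s ∈ S × h′ ≡ s · h)

IsCayAut : ∀ {n} (S : Subset n) → (Sym n ↔ Sym n) → Set
IsCayAut S g = ∀ h h′ → CayAdj S h h′ ⇔ CayAdj S (to h) (to h′)
  where open Inverse g

TAdj : ∀ {n} → Subset n → Fin n → Fin n → Set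
TAdj S i j = ∃[ s ] (s ∈ S × IsTranspositionOf s i j)

-- Line graph L(T(S)): vertex set identified with S (the edge {i,j} of T
-- is the transposition (i j) ∈ S).
LVertex : ∀ {n} → Subset n → Set
LVertex {n} S = Σ (Sym n) (λ s → s ∈ S)

Endpoint : ∀ {n} → Sym n → Fin n → Set
Endpoint s x = ∃[ y ] IsTranspositionOf s x y

LAdj : ∀ {n} (S : Subset n) → LVertex S → LVertex S → Set
LAdj S (s , _) (t , _) = s ≢ t × ∃[ x ] (Endpoint s x × Endpoint t x)

IsLAut : ∀ {n} (S : Subset n) → (LVertex S ↔ LVertex S) → Set
IsLAut S φ = ∀ a b → LAdj S a b ⇔ LAdj S (to a) (to b)
  where open Inverse φ

-- An automorphism φ of L(T) comes from a permutation π of the vertices of T (Whitney), and then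
-- conjugation by π is an automorphism of Cay(S_n, S) fixing e that maps each s ∈ S to φ s.
-- T is connected because S generates S_n. The edges through a vertex x of degree ≥ 2 are sent
-- to edges through one common point, which is π x: three edges of a star cannot be sent to a
-- triangle, because since n ≥ 5 some further edge leaves the star, and its image would meet
-- exactly one, or all three, sides of the triangle. A leaf, whose neighbour has degree ≥ 2, is
-- sent to the remaining endpoint of the image of its edge. The permutation built in the same
-- way from φ⁻¹ is inverse to π.

module Submission where

open import Defs
open import Data.Nat using (ℕ; _≤_; _<_)
open import Data.Nat.Properties using (<⇒≤)
open import Data.Fin using (Fin; zero; suc)
open import Data.Fin.Properties using (_≟_; any?; all?; pigeonhole; <⇒≢)
open import Data.Fin.Permutation.Components using (transpose; transpose-inverse)
open import Data.Vec using (tabulate)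
open import Data.Vec.Properties using (lookup∘tabulate; tabulate∘lookup; tabulate-cong)
open import Data.Bool.Properties using (T-irrelevant)
open import Data.Empty using (⊥; ⊥-elim)
open import Data.Sum using (_⊎_; inj₁; inj₂; [_,_])
open import Data.Product using (∃; ∃-syntax; _×_; _,_; proj₁; proj₂)
open import Function using (_∘_)
open import Function.Bundles using (_↔_; Inverse; Injection; mk↔ₛ′; mk⇔; Equivalence)
open import Function.Properties.Inverse using (↔-sym; ↔⇒↣)
open import Relation.Nullary using (¬_; Dec; yes; no)
open import Relation.Nullary.Decidable using (T?; ¬?; _×-dec_; _⊎-dec_)
open import Relation.Binary.PropositionalEquality
  using (_≡_; _≢_; refl; sym; trans; cong; subst; subst₂; module ≡-Reasoning)

module _ {n : ℕ} where

  transpose-matchˡ : (i j : Fin n) → transpose i j i ≡ j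
  transpose-matchˡ i j with i ≟ i
  ... | yes _  = refl
  ... | no i≢i = ⊥-elim (i≢i refl)

  transpose-matchʳ : (i j : Fin n) → transpose i j j ≡ i
  transpose-matchʳ i j with j ≟ i
  ... | yes j≡i = j≡i
  ... | no _ with j ≟ j
  ...   | yes _  = refl
  ...   | no j≢j = ⊥-elim (j≢j refl)

  transpose-mismatch : (i j k : Fin n) → k ≢ i → k ≢ j → transpose i j k ≡ k
  transpose-mismatch i j k k≢i k≢j with k ≟ i
  ... | yes k≡i = ⊥-elim (k≢i k≡i)
  ... | no _ with k ≟ j
  ...   | yes k≡j = ⊥-elim (k≢j k≡j)
  ...   | no _    = refl

  Sym-ext : {σ τ : Sym n} → (∀ k → app σ k ≡ app τ k) → σ ≡ τ
  Sym-ext {mkSym v _} {mkSym w _} σ≗τ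
    with trans (sym (tabulate∘lookup v)) (trans (tabulate-cong σ≗τ) (tabulate∘lookup w))
  ... | refl = refl

  fromInjection : (f : Fin n → Fin n) → .(∀ i j → f i ≡ f j → i ≡ j) → Sym n
  fromInjection f f-inj = mkSym (tabulate f) λ i j fi≡fj →
    f-inj i j (trans (sym (lookup∘tabulate f i)) (trans fi≡fj (lookup∘tabulate f j)))

  app-fromInjection : (f : Fin n → Fin n) .(f-inj : ∀ i j → f i ≡ f j → i ≡ j) →
                      ∀ k → app (fromInjection f f-inj) k ≡ f k
  app-fromInjection f _ = lookup∘tabulate f

  app-· : (σ τ : Sym n) (k : Fin n) → app (σ · τ) k ≡ app σ (app τ k)
  app-· (mkSym _ _) (mkSym _ _) = lookup∘tabulate _

  app-e : (k : Fin n) → app e k ≡ k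
  app-e = lookup∘tabulate (λ k → k)

  transpose-injective : (i j a b : Fin n) → transpose i j a ≡ transpose i j b → a ≡ b
  transpose-injective i j a b eq =
    trans (sym (transpose-inverse j i)) (trans (cong (transpose j i) eq) (transpose-inverse j i))

  transposition : Fin n → Fin n → Sym n
  transposition i j = fromInjection (transpose i j) (transpose-injective i j)

  OneOf : Fin n → Fin n → Fin n → Set
  OneOf i j z = z ≡ i ⊎ z ≡ j

  oneOf? : ∀ i j z → Dec (OneOf i j z)
  oneOf? i j z = (z ≟ i) ⊎-dec (z ≟ j)

  module _ {s : Sym n} {i j : Fin n} where

    IsTranspositionOf-intro : i ≢ j → app s i ≡ j → app s j ≡ i →
      (∀ k → k ≢ i → k ≢ j → app s k ≡ k) → IsTranspositionOf s i j
    IsTranspositionOf-intro i≢j si sj sk = i≢j , λ k → by-cases k (k ≟ i) (k ≟ j)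
      where
      by-cases : ∀ k → Dec (k ≡ i) → Dec (k ≡ j) → app s k ≡ transpose i j k
      by-cases _ (yes refl) _          = trans si (sym (transpose-matchˡ i j))
      by-cases _ (no _)     (yes refl) = trans sj (sym (transpose-matchʳ i j))
      by-cases k (no k≢i)   (no k≢j)   = trans (sk k k≢i k≢j) (sym (transpose-mismatch i j k k≢i k≢j))

    swaps : IsTranspositionOf s i j → app s i ≡ j
    swaps (_ , s≗τ) = trans (s≗τ i) (transpose-matchˡ i j)

    swapsʳ : IsTranspositionOf s i j → app s j ≡ i
    swapsʳ (_ , s≗τ) = trans (s≗τ j) (transpose-matchʳ i j)

    fixes : IsTranspositionOf s i j → ∀ {k} → k ≢ i → k ≢ j → app s k ≡ k
    fixes (_ , s≗τ) {k} k≢i k≢j = trans (s≗τ k) (transpose-mismatch i j k k≢i k≢j)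

    IsTranspositionOf-preserves : (A : Fin n → Set) → IsTranspositionOf s i j →
      (A i → A j) → (A j → A i) → ∀ {z} → A z → A (app s z)
    IsTranspositionOf-preserves A t i→j j→i {z} az with z ≟ i | z ≟ j
    ... | yes refl | _        = subst A (sym (swaps t)) (i→j az)
    ... | no _     | yes refl = subst A (sym (swapsʳ t)) (j→i az)
    ... | no z≢i   | no z≢j   = subst A (sym (fixes t z≢i z≢j)) az

  IsTranspositionOf-sym : ∀ {s i j} → IsTranspositionOf s i j → IsTranspositionOf s j i
  IsTranspositionOf-sym {s} t@(i≢j , _) =
    IsTranspositionOf-intro {s} (i≢j ∘ sym) (swapsʳ {s} t) (swaps {s} t)
      (λ k k≢j k≢i → fixes {s} t k≢i k≢j)

  transposition-isTranspositionOf : ∀ {i j} → i ≢ j → IsTranspositionOf (transposition i j) i j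
  transposition-isTranspositionOf {i} {j} i≢j =
    i≢j , app-fromInjection (transpose i j) (transpose-injective i j)

  IsTranspositionOf-unique : ∀ {s t i j} → IsTranspositionOf s i j → IsTranspositionOf t i j → s ≡ t
  IsTranspositionOf-unique (_ , s≗τ) (_ , t≗τ) = Sym-ext λ k → trans (s≗τ k) (sym (t≗τ k))

  IsTranspositionOf-ends : ∀ {s i j i′ j′} → IsTranspositionOf s i j → IsTranspositionOf s i′ j′ →
                           (i ≡ i′ × j ≡ j′) ⊎ (i ≡ j′ × j ≡ i′)
  IsTranspositionOf-ends {s} {i} {j} {i′} {j′} t t′ with i ≟ i′ | i ≟ j′
  ... | yes refl | _        = inj₁ (refl , trans (sym (swaps {s} t)) (swaps {s} t′))
  ... | no _     | yes refl = inj₂ (refl , trans (sym (swaps {s} t)) (swapsʳ {s} t′))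
  ... | no i≢i′  | no i≢j′  = ⊥-elim (proj₁ t (trans (sym (fixes {s} t′ i≢i′ i≢j′)) (swaps {s} t)))

  Endpoint-oneOf : ∀ {s i j z} → IsTranspositionOf s i j → Endpoint s z → OneOf i j z
  Endpoint-oneOf {s} t (_ , t′) with IsTranspositionOf-ends {s} t′ t
  ... | inj₁ (z≡i , _) = inj₁ z≡i
  ... | inj₂ (z≡j , _) = inj₂ z≡j

  oneOf-Endpoint : ∀ {s i j z} → IsTranspositionOf s i j → OneOf i j z → Endpoint s z
  oneOf-Endpoint {j = j} t (inj₁ refl) = j , t
  oneOf-Endpoint {s} {i} t (inj₂ refl) = i , IsTranspositionOf-sym {s} t

  Endpoint-pair : ∀ {s z z′} → Endpoint s z → Endpoint s z′ → z ≢ z′ → IsTranspositionOf s z z′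
  Endpoint-pair {s} (y , t) sz′ z≢z′ with Endpoint-oneOf {s} t sz′
  ... | inj₁ z′≡z = ⊥-elim (z≢z′ (sym z′≡z))
  ... | inj₂ refl = t

-- If f : Fin k → Fin n hit every point, a right inverse of f would be injective.
missingPoint : ∀ {k n} → k < n → (f : Fin k → Fin n) → ∃[ w ] (∀ i → f i ≢ w)
missingPoint {k} {n} k<n f with any? (λ w → all? (λ i → ¬? (f i ≟ w)))
... | yes missed = missed
... | no ¬missed = ⊥-elim (<⇒≢ i<j (trans (sym (f∘g i)) (trans (cong f gi≡gj) (f∘g j))))
  where
  preimage : ∀ w → ∃[ i ] (f i ≡ w)
  preimage w with any? (λ i → f i ≟ w)
  ... | yes hit = hit
  ... | no ¬hit = ⊥-elim (¬missed (w , λ i fi≡w → ¬hit (i , fi≡w)))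
  g : Fin n → Fin k
  g w = proj₁ (preimage w)
  f∘g : ∀ w → f (g w) ≡ w
  f∘g w = proj₂ (preimage w)
  collision = pigeonhole k<n g
  i = proj₁ collision
  j = proj₁ (proj₂ collision)
  i<j = proj₁ (proj₂ (proj₂ collision))
  gi≡gj = proj₂ (proj₂ (proj₂ collision))

module _ {n : ℕ} where

  toSym : Fin n ↔ Fin n → Sym n
  toSym ρ = fromInjection (Inverse.to ρ) (λ _ _ → Injection.injective (↔⇒↣ ρ))

  app-toSym : (ρ : Fin n ↔ Fin n) → ∀ k → app (toSym ρ) k ≡ Inverse.to ρ k
  app-toSym ρ = lookup∘tabulate (Inverse.to ρ)

  module _ (ρ : Fin n ↔ Fin n) where
    open Inverse ρ using (to; from; strictlyInverseˡ; strictlyInverseʳ)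
    open Injection (↔⇒↣ ρ) using (injective)

    conjugate : Sym n → Sym n
    conjugate h = toSym ρ · (h · toSym (↔-sym ρ))

    app-conjugate : ∀ h k → app (conjugate h) k ≡ to (app h (from k))
    app-conjugate h k = begin
      app (toSym ρ · (h · toSym (↔-sym ρ))) k  ≡⟨ app-· (toSym ρ) (h · toSym (↔-sym ρ)) k ⟩
      app (toSym ρ) (app (h · toSym (↔-sym ρ)) k) ≡⟨ app-toSym ρ (app (h · toSym (↔-sym ρ)) k) ⟩
      to (app (h · toSym (↔-sym ρ)) k)           ≡⟨ cong to (app-· h (toSym (↔-sym ρ)) k) ⟩
      to (app h (app (toSym (↔-sym ρ)) k))       ≡⟨ cong (to ∘ app h) (app-toSym (↔-sym ρ) k) ⟩
      to (app h (from k))                        ∎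
      where open ≡-Reasoning

    conjugate-e : conjugate e ≡ e
    conjugate-e = Sym-ext λ k →
      trans (app-conjugate e k) (trans (cong to (app-e _)) (trans (strictlyInverseˡ k) (sym (app-e k))))

    conjugate-· : ∀ σ τ → conjugate (σ · τ) ≡ conjugate σ · conjugate τ
    conjugate-· σ τ = Sym-ext λ k → begin
      app (conjugate (σ · τ)) k                 ≡⟨ app-conjugate (σ · τ) k ⟩
      to (app (σ · τ) (from k))                 ≡⟨ cong to (app-· σ τ (from k)) ⟩
      to (app σ (app τ (from k)))               ≡⟨ cong (to ∘ app σ) (strictlyInverseʳ _) ⟨
      to (app σ (from (to (app τ (from k)))))   ≡⟨ app-conjugate σ (to (app τ (from k))) ⟨
      app (conjugate σ) (to (app τ (from k)))   ≡⟨ cong (app (conjugate σ)) (app-conjugate τ k) ⟨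
      app (conjugate σ) (app (conjugate τ) k)   ≡⟨ app-· (conjugate σ) (conjugate τ) k ⟨
      app (conjugate σ · conjugate τ) k         ∎
      where open ≡-Reasoning

    conjugate-transposition : ∀ {s i j} → IsTranspositionOf s i j →
                              IsTranspositionOf (conjugate s) (to i) (to j)
    conjugate-transposition {s} {i} {j} t = IsTranspositionOf-intro {s = conjugate s}
      (proj₁ t ∘ injective)
      (sends i (swaps {s = s} t)) (sends j (swapsʳ {s = s} t))
      λ k k≢toi k≢toj → trans (app-conjugate s k)
        (trans (cong to (fixes {s = s} t (avoids k≢toi) (avoids k≢toj))) (strictlyInverseˡ k))
      where
      sends : ∀ x {y} → app s x ≡ y → app (conjugate s) (to x) ≡ to y
      sends x sx≡y =
        trans (app-conjugate s (to x)) (cong to (trans (cong (app s) (strictlyInverseʳ x)) sx≡y))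
      avoids : ∀ {k x} → k ≢ to x → from k ≢ x
      avoids k≢tox fromk≡x = k≢tox (trans (sym (strictlyInverseˡ _)) (cong to fromk≡x))

  conjugate-inverse : (ρ : Fin n ↔ Fin n) → ∀ h → conjugate (↔-sym ρ) (conjugate ρ h) ≡ h
  conjugate-inverse ρ h = Sym-ext λ k → begin
    app (conjugate (↔-sym ρ) (conjugate ρ h)) k  ≡⟨ app-conjugate (↔-sym ρ) (conjugate ρ h) k ⟩
    from (app (conjugate ρ h) (to k))           ≡⟨ cong from (app-conjugate ρ h (to k)) ⟩
    from (to (app h (from (to k))))             ≡⟨ strictlyInverseʳ _ ⟩
    app h (from (to k))                         ≡⟨ cong (app h) (strictlyInverseʳ k) ⟩
    app h k                                     ∎
    where
    open ≡-Reasoning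
    open Inverse ρ

  conjugation : Fin n ↔ Fin n → Sym n ↔ Sym n
  conjugation ρ = mk↔ₛ′ (conjugate ρ) (conjugate (↔-sym ρ))
                        (conjugate-inverse (↔-sym ρ)) (conjugate-inverse ρ)

  automorphism-isCayAut : (S : Subset n) (G : Sym n ↔ Sym n) →
    (∀ σ τ → Inverse.to G (σ · τ) ≡ Inverse.to G σ · Inverse.to G τ) →
    (∀ {s} → s ∈ S → Inverse.to G s ∈ S) → (∀ {t} → t ∈ S → Inverse.from G t ∈ S) → IsCayAut S G
  automorphism-isCayAut S G hom to-∈ from-∈ h h′ = mk⇔
    (λ { (s , s∈S , h′≡sh) → to s , to-∈ s∈S , trans (cong to h′≡sh) (hom s h) })
    (λ { (t , t∈S , Gh′≡tGh) → from t , from-∈ t∈S , lift Gh′≡tGh })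
    where
    open Inverse G
    open ≡-Reasoning
    lift : ∀ {t} → to h′ ≡ t · to h → h′ ≡ from t · h
    lift {t} Gh′≡tGh = begin
      h′                       ≡⟨ strictlyInverseʳ h′ ⟨
      from (to h′)             ≡⟨ cong from Gh′≡tGh ⟩
      from (t · to h)          ≡⟨ cong (λ u → from (u · to h)) (strictlyInverseˡ t) ⟨
      from (to (from t) · to h) ≡⟨ cong from (hom (from t) h) ⟨
      from (to (from t · h))   ≡⟨ strictlyInverseʳ _ ⟩
      from t · h               ∎

module TranspositionGraph {n : ℕ} (S : Subset n) where

  TAdj? : ∀ x y → Dec (TAdj S x y)
  TAdj? x y with x ≟ y
  ... | yes refl = no λ { (_ , _ , t) → proj₁ t refl }
  ... | no x≢y with T? (S (transposition x y))
  ...   | yes xy∈S = yes (transposition x y , xy∈S , transposition-isTranspositionOf x≢y)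
  ...   | no xy∉S  = no λ { (s , s∈S , t) → xy∉S (subst (_∈ S)
                      (IsTranspositionOf-unique {s = s} t (transposition-isTranspositionOf x≢y)) s∈S) }

  TAdj-sym : ∀ {x y} → TAdj S x y → TAdj S y x
  TAdj-sym (s , s∈S , t) = s , s∈S , IsTranspositionOf-sym {s = s} t

  TAdj-irrefl : ∀ {x y} → TAdj S x y → x ≢ y
  TAdj-irrefl (_ , _ , t) = proj₁ t

  Branching : Fin n → Set
  Branching x = ∃[ u ] ∃[ v ] (u ≢ v × TAdj S x u × TAdj S x v)

  branching? : ∀ x → Dec (Branching x)
  branching? x = any? λ u → any? λ v → ¬? (u ≟ v) ×-dec (TAdj? x u ×-dec TAdj? x v)

  ¬Branching-neighbour-unique : ∀ {x u v} → ¬ Branching x → TAdj S x u → TAdj S x v → u ≡ v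
  ¬Branching-neighbour-unique {u = u} {v} ¬bx xu xv with u ≟ v
  ... | yes u≡v = u≡v
  ... | no u≢v  = ⊥-elim (¬bx (u , v , u≢v , xu , xv))

  other-neighbour : ∀ {x} → Branching x → ∀ y → ∃[ a ] (a ≢ y × TAdj S x a)
  other-neighbour (u , v , u≢v , xu , xv) y with u ≟ y
  ... | yes refl = v , u≢v ∘ sym , xv
  ... | no u≢y   = u , u≢y , xu

  module Connected (trh : ∀ s → s ∈ S → IsTransposition s) (gens : GeneratesSym S) where

    Closed : (Fin n → Set) → Set
    Closed A = ∀ {y k} → A y → TAdj S y k → A k

    Closed-invariant : ∀ {A} → Closed A → ∀ {σ} → Generated S σ → ∀ {y} → A y → A (app σ y)
    Closed-invariant {A} _ gen-e {y} ay = subst A (sym (app-e y)) ay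
    Closed-invariant {A} closed (gen-· {s} {σ} s∈S gσ) {y} ay with trh s s∈S
    ... | _ , _ , t = subst A (sym (app-· s σ y))
      (IsTranspositionOf-preserves {s = s} A t (λ ai → closed ai (s , s∈S , t))
        (λ aj → closed aj (s , s∈S , IsTranspositionOf-sym {s = s} t)) (Closed-invariant closed gσ ay))

    crossing : (A : Fin n → Set) → (∀ y → Dec (A y)) → ∀ {a w} → A a → ¬ A w →
               ∃[ y ] ∃[ k ] (A y × ¬ A k × TAdj S y k)
    crossing A A? {a} {w} aa ¬aw with any? (λ y → any? λ k → A? y ×-dec (¬? (A? k) ×-dec TAdj? y k))
    ... | yes edge = edge
    ... | no ¬edge = ⊥-elim (¬aw (subst A
          (swaps {s = transposition a w} (transposition-isTranspositionOf a≢w))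
          (Closed-invariant closed (gens (transposition a w)) aa)))
      where
      a≢w : a ≢ w
      a≢w refl = ¬aw aa
      closed : Closed A
      closed {y} {k} ay yk with A? k
      ... | yes ak = ak
      ... | no ¬ak = ⊥-elim (¬edge (y , k , ay , ¬ak , yk))

    neighbour : 1 < n → ∀ x → ∃ (TAdj S x)
    neighbour 1<n x with missingPoint 1<n (λ _ → x)
    ... | w , x≢w with crossing (_≡ x) (_≟ x) refl (λ w≡x → x≢w zero (sym w≡x))
    ...   | _ , k , refl , _ , xk = k , xk

    ¬adjacent-unbranched : 2 < n → ∀ {x y} → TAdj S x y → ¬ Branching x → ¬ Branching y → ⊥
    ¬adjacent-unbranched 2<n {x} {y} xy ¬bx ¬by
      with missingPoint 2<n (λ { zero → x ; (suc _) → y })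
    ... | w , ≢w with crossing (OneOf x y) (oneOf? x y) (inj₁ refl)
                        (λ { (inj₁ w≡x) → ≢w zero (sym w≡x) ; (inj₂ w≡y) → ≢w (suc zero) (sym w≡y) })
    ... | _ , k , inj₁ refl , k∉ , xk = ¬bx (y , k , (λ y≡k → k∉ (inj₂ (sym y≡k))) , xy , xk)
    ... | _ , k , inj₂ refl , k∉ , yk = ¬by (x , k , (λ x≡k → k∉ (inj₁ (sym x≡k))) , TAdj-sym xy , yk)

    branching-or-adjacent : 2 < n → ∀ x →
      Branching x ⊎ (¬ Branching x × ∃[ u ] (TAdj S x u × Branching u))
    branching-or-adjacent 2<n x with branching? x
    ... | yes bx = inj₁ bx
    ... | no ¬bx with neighbour (<⇒≤ 2<n) x
    ...   | u , xu with branching? u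
    ...     | yes bu = inj₂ (¬bx , u , xu , bu)
    ...     | no ¬bu = ⊥-elim (¬adjacent-unbranched 2<n xu ¬bx ¬bu)

module LineGraph {n : ℕ} (S : Subset n) (trh : ∀ s → s ∈ S → IsTransposition s) where

  open TranspositionGraph S

  infix 4 _∋_ _≉_

  record _∋_ (a : LVertex S) (z : Fin n) : Set where
    constructor endpoint
    field isEndpoint : Endpoint (proj₁ a) z

  _≉_ : LVertex S → LVertex S → Set
  a ≉ b = proj₁ a ≢ proj₁ b

  Meet : LVertex S → LVertex S → Set
  Meet a b = ∃[ z ] (a ∋ z × b ∋ z)

  Meet-sym : ∀ {a b} → Meet a b → Meet b a
  Meet-sym (z , az , bz) = z , bz , az

  LAdj-intro : ∀ {a b} → a ≉ b → Meet a b → LAdj S a b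
  LAdj-intro a≉b (z , endpoint az , endpoint bz) = a≉b , z , az , bz

  LAdj⇒Meet : ∀ {a b} → LAdj S a b → Meet a b
  LAdj⇒Meet (_ , z , az , bz) = z , endpoint az , endpoint bz

  LVertex-≡ : ∀ {a b : LVertex S} → proj₁ a ≡ proj₁ b → a ≡ b
  LVertex-≡ {s , p} {.s , q} refl = cong (s ,_) (T-irrelevant p q)

  ≉-by : ∀ {a b z} → a ∋ z → ¬ b ∋ z → a ≉ b
  ≉-by {z = z} (endpoint az) b∌z a≡b = b∌z (endpoint (subst (λ s → Endpoint s z) a≡b az))

  ∋? : ∀ a z → Dec (a ∋ z)
  ∋? a@(s , s∈S) z with trh s s∈S
  ... | i , j , t with oneOf? i j z
  ...   | yes z∈ij = yes (endpoint (oneOf-Endpoint {s = s} t z∈ij))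
  ...   | no z∉ij  = no λ { (endpoint sz) → z∉ij (Endpoint-oneOf {s = s} t sz) }

  ∋-app : ∀ {a z} → a ∋ z → a ∋ app (proj₁ a) z
  ∋-app {s , _} {z} (endpoint (y , t)) =
    endpoint (subst (Endpoint s) (sym (swaps {s = s} t)) (z , IsTranspositionOf-sym {s = s} t))

  app-≢ : ∀ {a z} → a ∋ z → app (proj₁ a) z ≢ z
  app-≢ {s , _} (endpoint (y , t)) sz≡z = proj₁ t (trans (sym sz≡z) (swaps {s = s} t))

  ∋-other : ∀ {a z y} → a ∋ z → a ∋ y → y ≢ z → y ≡ app (proj₁ a) z
  ∋-other {s , _} (endpoint (y′ , t)) (endpoint sy) y≢z with Endpoint-oneOf {s = s} t sy
  ... | inj₁ y≡z  = ⊥-elim (y≢z y≡z)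
  ... | inj₂ y≡y′ = trans y≡y′ (sym (swaps {s = s} t))

  ∋-two-ends : ∀ {a z z₁ z₂} → a ∋ z → a ∋ z₁ → a ∋ z₂ → z₁ ≢ z → z₂ ≢ z → z₁ ≡ z₂
  ∋-two-ends az az₁ az₂ z₁≢z z₂≢z = trans (∋-other az az₁ z₁≢z) (sym (∋-other az az₂ z₂≢z))

  meet-unique : ∀ {a b z z′} → a ≉ b → a ∋ z → b ∋ z → a ∋ z′ → b ∋ z′ → z ≡ z′
  meet-unique {a} {b} {z} {z′} a≉b (endpoint az) (endpoint bz) (endpoint az′) (endpoint bz′)
    with z ≟ z′
  ... | yes z≡z′ = z≡z′
  ... | no z≢z′  = ⊥-elim (a≉b (IsTranspositionOf-unique {s = proj₁ a}
                     (Endpoint-pair {s = proj₁ a} az az′ z≢z′)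
                     (Endpoint-pair {s = proj₁ b} bz bz′ z≢z′)))

  CommonPoint : LVertex S → LVertex S → LVertex S → Set
  CommonPoint a b c = ∃[ z ] (a ∋ z × b ∋ z × c ∋ z)

  Triangle : LVertex S → LVertex S → LVertex S → Set
  Triangle a b c = Meet a b × Meet a c × Meet b c × ¬ CommonPoint a b c

  CommonPoint-or-Triangle : ∀ {a b c} → Meet a b → Meet a c → Meet b c →
                            CommonPoint a b c ⊎ Triangle a b c
  CommonPoint-or-Triangle {a} {b} {c} ab ac bc with any? (λ z → ∋? a z ×-dec (∋? b z ×-dec ∋? c z))
  ... | yes common = inj₁ common
  ... | no none    = inj₂ (ab , ac , bc , none)

  Triangle-rotate : ∀ {a b c} → Triangle a b c → Triangle b c a
  Triangle-rotate (ab , ac , bc , none) =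
    bc , Meet-sym ab , Meet-sym ac , λ (z , bz , cz , az) → none (z , az , bz , cz)

  Triangle-swap : ∀ {a b c} → Triangle a b c → Triangle b a c
  Triangle-swap (ab , ac , bc , none) =
    Meet-sym ab , bc , ac , λ (z , bz , az , cz) → none (z , az , bz , cz)

  Triangle-cover : ∀ {a b c x} → Triangle a b c → a ∋ x → b ∋ x ⊎ c ∋ x
  Triangle-cover {x = x} ((z₁ , az₁ , bz₁) , (z₂ , az₂ , cz₂) , _ , none) ax with z₁ ≟ x | z₂ ≟ x
  ... | yes refl | _        = inj₁ bz₁
  ... | no _     | yes refl = inj₂ cz₂
  ... | no z₁≢x  | no z₂≢x with ∋-two-ends ax az₁ az₂ z₁≢x z₂≢x
  ...   | refl = ⊥-elim (none (z₁ , az₁ , bz₁ , cz₂))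

  Pendant : LVertex S → LVertex S → LVertex S → LVertex S → Set
  Pendant d a b c = Meet d a × ¬ Meet d b × ¬ Meet d c

  ¬Triangle-pendant : ∀ {a b c d} → Triangle a b c → ¬ Pendant d a b c
  ¬Triangle-pendant tri ((z , dz , az) , ¬db , ¬dc) with Triangle-cover tri az
  ... | inj₁ bz = ¬db (z , dz , bz)
  ... | inj₂ cz = ¬dc (z , dz , cz)

  -- The third side w passes through t, so one of x, y does too and then shares both s and t with d.
  Triangle-shared-ends : ∀ {x y w d s t} → Triangle x y w → d ≉ x → d ≉ y →
                         d ∋ s → x ∋ s → y ∋ s → d ∋ t → w ∋ t → s ≡ t
  Triangle-shared-ends tri d≉x d≉y ds xs ys dt wt
    with Triangle-cover (Triangle-rotate (Triangle-rotate tri)) wt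
  ... | inj₁ xt = meet-unique d≉x ds xs dt xt
  ... | inj₂ yt = meet-unique d≉y ds ys dt yt

  ¬Triangle-meets-all : ∀ {a b c d} → Triangle a b c → d ≉ a → d ≉ b → d ≉ c →
                        Meet d a → Meet d b → ¬ Meet d c
  ¬Triangle-meets-all tri d≉a d≉b d≉c (z₁ , dz₁ , az₁) (z₂ , dz₂ , bz₂) (z₃ , dz₃ , cz₃)
    with z₁ ≟ z₂ | z₁ ≟ z₃
  ... | yes refl | yes refl = proj₂ (proj₂ (proj₂ tri)) (z₁ , az₁ , bz₂ , cz₃)
  ... | yes refl | no z₁≢z₃ = z₁≢z₃ (Triangle-shared-ends tri d≉a d≉b dz₁ az₁ bz₂ dz₃ cz₃)
  ... | no z₁≢z₂ | yes refl =
    z₁≢z₂ (Triangle-shared-ends (Triangle-rotate (Triangle-swap tri)) d≉a d≉c dz₁ az₁ cz₃ dz₂ bz₂)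
  ... | no z₁≢z₂ | no z₁≢z₃ with ∋-two-ends dz₁ dz₂ dz₃ (z₁≢z₂ ∘ sym) (z₁≢z₃ ∘ sym)
  ...   | refl = z₁≢z₂ (sym (Triangle-shared-ends (Triangle-rotate tri) d≉b d≉c dz₂ bz₂ cz₃ dz₁ az₁))

  edge : ∀ {x y} → TAdj S x y → LVertex S
  edge (s , s∈S , _) = s , s∈S

  edge-∋ˡ : ∀ {x y} (xy : TAdj S x y) → edge xy ∋ x
  edge-∋ˡ {y = y} (_ , _ , t) = endpoint (y , t)

  edge-∋ʳ : ∀ {x y} (xy : TAdj S x y) → edge xy ∋ y
  edge-∋ʳ {x} (s , _ , t) = endpoint (x , IsTranspositionOf-sym {s = s} t)

  edge-oneOf : ∀ {x y z} (xy : TAdj S x y) → edge xy ∋ z → OneOf x y z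
  edge-oneOf (s , _ , t) (endpoint sz) = Endpoint-oneOf {s = s} t sz

  edge-irrelevant : ∀ {x y} (xy xy′ : TAdj S x y) → edge xy ≡ edge xy′
  edge-irrelevant (s , _ , t) (s′ , _ , t′) = LVertex-≡ (IsTranspositionOf-unique {s = s} {t = s′} t t′)

  edge-≉ : ∀ {x u v} (xu : TAdj S x u) (xv : TAdj S x v) → u ≢ v → edge xu ≉ edge xv
  edge-≉ xu xv u≢v = ≉-by (edge-∋ʳ xu) ([ TAdj-irrefl xu ∘ sym , u≢v ] ∘ edge-oneOf xv)

  edges-disjoint : ∀ {x a y b} (xa : TAdj S x a) (yb : TAdj S y b) →
                   ¬ OneOf y b x → ¬ OneOf y b a → ¬ Meet (edge xa) (edge yb)
  edges-disjoint xa yb x∉yb a∉yb (z , xa∋z , yb∋z) with edge-oneOf xa xa∋z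
  ... | inj₁ refl = x∉yb (edge-oneOf yb yb∋z)
  ... | inj₂ refl = a∉yb (edge-oneOf yb yb∋z)

  ¬CommonPoint-triangle : ∀ {x y w} (xy : TAdj S x y) (xw : TAdj S x w) (yw : TAdj S y w) →
                          ¬ CommonPoint (edge xy) (edge xw) (edge yw)
  ¬CommonPoint-triangle xy xw yw (z , xy∋z , xw∋z , yw∋z) with edge-oneOf xy xy∋z
  ... | inj₁ refl = [ TAdj-irrefl xy , TAdj-irrefl xw ] (edge-oneOf yw yw∋z)
  ... | inj₂ refl = [ TAdj-irrefl xy ∘ sym , TAdj-irrefl yw ] (edge-oneOf xw xw∋z)

  OnAny : LVertex S → LVertex S → LVertex S → Fin n → Set
  OnAny a b c y = a ∋ y ⊎ b ∋ y ⊎ c ∋ y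

  onAny? : ∀ a b c y → Dec (OnAny a b c y)
  onAny? a b c y = ∋? a y ⊎-dec (∋? b y ⊎-dec ∋? c y)

  -- Three edges through z cover at most four points: z and their far ends.
  outside-star : 4 < n → ∀ {a b c z} → a ∋ z → b ∋ z → c ∋ z → ∃[ w ] ¬ OnAny a b c w
  outside-star 4<n {a} {b} {c} {z} az bz cz = w , λ
    { (inj₁ aw)        → off (suc zero) refl az aw
    ; (inj₂ (inj₁ bw)) → off (suc (suc zero)) refl bz bw
    ; (inj₂ (inj₂ cw)) → off (suc (suc (suc zero))) refl cz cw }
    where
    points : Fin 4 → Fin n
    points zero                   = z
    points (suc zero)             = app (proj₁ a) z
    points (suc (suc zero))       = app (proj₁ b) z
    points (suc (suc (suc zero))) = app (proj₁ c) z
    w = proj₁ (missingPoint 4<n points)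
    off : ∀ {x} i → points i ≡ app (proj₁ x) z → x ∋ z → x ∋ w → ⊥
    off i pᵢ≡far xz xw with w ≟ z
    ... | yes w≡z = proj₂ (missingPoint 4<n points) zero (sym w≡z)
    ... | no w≢z  = proj₂ (missingPoint 4<n points) i (trans pᵢ≡far (sym (∋-other xz xw w≢z)))

  star-extension : GeneratesSym S → 4 < n → ∀ {a b c z} → a ≉ b → a ≉ c → b ≉ c →
    a ∋ z → b ∋ z → c ∋ z →
    ∃[ d ] (d ≉ a × d ≉ b × d ≉ c × (d ∋ z ⊎ Pendant d a b c ⊎ Pendant d b a c ⊎ Pendant d c a b))
  star-extension gens 4<n {a} {b} {c} {z} a≉b a≉c b≉c az bz cz
    with Connected.crossing trh gens (OnAny a b c) (onAny? a b c) (inj₁ az)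
                            (proj₂ (outside-star 4<n az bz cz))
  ... | y , k , y∈ , k∉ , (s , s∈S , t) =
    d , ≉-by dk (k∉ ∘ inj₁) , ≉-by dk (k∉ ∘ inj₂ ∘ inj₁) , ≉-by dk (k∉ ∘ inj₂ ∘ inj₂) , shape y∈
    where
    d : LVertex S
    d = s , s∈S
    dy : d ∋ y
    dy = endpoint (k , t)
    dk : d ∋ k
    dk = endpoint (y , IsTranspositionOf-sym {s = s} t)
    misses : ∀ {x} → ¬ x ∋ y → ¬ x ∋ k → ¬ Meet d x
    misses x∌y x∌k (q , endpoint dq , xq) with Endpoint-oneOf {s = s} t dq
    ... | inj₁ refl = x∌y xq
    ... | inj₂ refl = x∌k xq
    shape : OnAny a b c y → d ∋ z ⊎ Pendant d a b c ⊎ Pendant d b a c ⊎ Pendant d c a b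
    shape y∈ with y ≟ z
    shape _ | yes refl = inj₁ dy
    shape (inj₁ ay) | no y≢z = inj₂ (inj₁ ((y , dy , ay) ,
      misses (λ by → y≢z (meet-unique a≉b ay by az bz)) (k∉ ∘ inj₂ ∘ inj₁) ,
      misses (λ cy → y≢z (meet-unique a≉c ay cy az cz)) (k∉ ∘ inj₂ ∘ inj₂)))
    shape (inj₂ (inj₁ by)) | no y≢z = inj₂ (inj₂ (inj₁ ((y , dy , by) ,
      misses (λ ay → y≢z (meet-unique a≉b ay by az bz)) (k∉ ∘ inj₁) ,
      misses (λ cy → y≢z (meet-unique b≉c by cy bz cz)) (k∉ ∘ inj₂ ∘ inj₂))))
    shape (inj₂ (inj₂ cy)) | no y≢z = inj₂ (inj₂ (inj₂ ((y , dy , cy) ,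
      misses (λ ay → y≢z (meet-unique a≉c ay cy az cz)) (k∉ ∘ inj₁) ,
      misses (λ by → y≢z (meet-unique b≉c by cy bz cz)) (k∉ ∘ inj₂ ∘ inj₁))))

  IsLAut-sym : (φ : LVertex S ↔ LVertex S) → IsLAut S φ → IsLAut S (↔-sym φ)
  IsLAut-sym φ φ-aut a b = mk⇔
    (λ ab → Equivalence.from (φ-aut (from a) (from b))
              (subst₂ (LAdj S) (sym (strictlyInverseˡ a)) (sym (strictlyInverseˡ b)) ab))
    (λ ab → subst₂ (LAdj S) (strictlyInverseˡ a) (strictlyInverseˡ b)
              (Equivalence.to (φ-aut (from a) (from b)) ab))
    where open Inverse φ

  Induces : (LVertex S ↔ LVertex S) → (Fin n → Fin n) → Set
  Induces φ π = ∀ a {i j} → IsTranspositionOf (proj₁ a) i j →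
                IsTranspositionOf (proj₁ (Inverse.to φ a)) (π i) (π j)

  conjugate-restricts : ∀ ρ φ → Induces φ (Inverse.to ρ) →
                        ∀ a → conjugate ρ (proj₁ a) ≡ proj₁ (Inverse.to φ a)
  conjugate-restricts ρ φ ρ-induces a@(s , s∈S) with trh s s∈S
  ... | _ , _ , t =
    IsTranspositionOf-unique {s = conjugate ρ s} (conjugate-transposition ρ {s = s} t) (ρ-induces a t)

  conjugate-∈ : ∀ ρ φ → Induces φ (Inverse.to ρ) → ∀ {s} → s ∈ S → conjugate ρ s ∈ S
  conjugate-∈ ρ φ ρ-induces {s} s∈S =
    subst (_∈ S) (sym (conjugate-restricts ρ φ ρ-induces (s , s∈S))) (proj₂ (Inverse.to φ (s , s∈S)))

  module InducedInverse (φ : LVertex S ↔ LVertex S) {π ψ : Fin n → Fin n}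
                        (π-induces : Induces φ π) (ψ-induces : Induces (↔-sym φ) ψ) where

    ψ∘π-edge : ∀ {x u} → TAdj S x u → (ψ (π x) ≡ x × ψ (π u) ≡ u) ⊎ (ψ (π x) ≡ u × ψ (π u) ≡ x)
    ψ∘π-edge (s , s∈S , t) = IsTranspositionOf-ends {s = s}
      (subst (λ a → IsTranspositionOf (proj₁ a) _ _) (Inverse.strictlyInverseʳ φ (s , s∈S))
             (ψ-induces (Inverse.to φ (s , s∈S)) (π-induces (s , s∈S) t)))
      t

    ψ∘π-branching : ∀ {x} → Branching x → ψ (π x) ≡ x
    ψ∘π-branching (_ , _ , u≢v , xu , xv) with ψ∘π-edge xu | ψ∘π-edge xv
    ... | inj₁ (ψπx≡x , _) | _                  = ψπx≡x
    ... | inj₂ _           | inj₁ (ψπx≡x , _)   = ψπx≡x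
    ... | inj₂ (ψπx≡u , _) | inj₂ (ψπx≡v , _)   = ⊥-elim (u≢v (trans (sym ψπx≡u) ψπx≡v))

    ψ∘π≡id : GeneratesSym S → 2 < n → ∀ x → ψ (π x) ≡ x
    ψ∘π≡id gens 2<n x with Connected.branching-or-adjacent trh gens 2<n x
    ... | inj₁ bx = ψ∘π-branching bx
    ... | inj₂ (_ , u , xu , bu) with ψ∘π-edge xu
    ...   | inj₁ (ψπx≡x , _) = ψπx≡x
    ...   | inj₂ (_ , ψπu≡x) = ⊥-elim (TAdj-irrefl xu (trans (sym ψπu≡x) (ψ∘π-branching bu)))

module LineGraphAutomorphism {n : ℕ} (S : Subset n) (trh : ∀ s → s ∈ S → IsTransposition s)
                             (φ : LVertex S ↔ LVertex S) (φ-aut : IsLAut S φ) where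

  open LineGraph S trh
  open Inverse φ using (to; from; strictlyInverseʳ)

  to-≉ : ∀ {a b} → a ≉ b → to a ≉ to b
  to-≉ {a} {b} a≉b toa≈tob = a≉b (cong proj₁ (begin
    a            ≡⟨ strictlyInverseʳ a ⟨
    from (to a)  ≡⟨ cong from (LVertex-≡ toa≈tob) ⟩
    from (to b)  ≡⟨ strictlyInverseʳ b ⟩
    b            ∎))
    where open ≡-Reasoning

  to-Meet : ∀ {a b} → a ≉ b → Meet a b → Meet (to a) (to b)
  to-Meet {a} {b} a≉b ab =
    LAdj⇒Meet {to a} {to b} (Equivalence.to (φ-aut a b) (LAdj-intro {a} {b} a≉b ab))

  from-Meet : ∀ {a b} → a ≉ b → Meet (to a) (to b) → Meet a b
  from-Meet {a} {b} a≉b ab =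
    LAdj⇒Meet {a} {b} (Equivalence.from (φ-aut a b) (LAdj-intro {to a} {to b} (to-≉ a≉b) ab))

  to-Pendant : ∀ {d a b c} → d ≉ a → d ≉ b → d ≉ c →
               Pendant d a b c → Pendant (to d) (to a) (to b) (to c)
  to-Pendant d≉a d≉b d≉c (da , ¬db , ¬dc) = to-Meet d≉a da , ¬db ∘ from-Meet d≉b , ¬dc ∘ from-Meet d≉c

  -- A star's image is a star or a triangle; a fourth edge attached to the star rules out the triangle.
  star-preserved : GeneratesSym S → 4 < n → ∀ {a b c z} → a ≉ b → a ≉ c → b ≉ c →
                   a ∋ z → b ∋ z → c ∋ z → CommonPoint (to a) (to b) (to c)
  star-preserved gens 4<n {a} {b} {c} {z} a≉b a≉c b≉c az bz cz
    with CommonPoint-or-Triangle (to-Meet a≉b (z , az , bz)) (to-Meet a≉c (z , az , cz))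
                                 (to-Meet b≉c (z , bz , cz))
  ... | inj₁ common = common
  ... | inj₂ triangle with star-extension gens 4<n a≉b a≉c b≉c az bz cz
  ...   | d , d≉a , d≉b , d≉c , inj₁ dz =
    ⊥-elim (¬Triangle-meets-all triangle (to-≉ d≉a) (to-≉ d≉b) (to-≉ d≉c)
              (to-Meet d≉a (z , dz , az)) (to-Meet d≉b (z , dz , bz)) (to-Meet d≉c (z , dz , cz)))
  ...   | d , d≉a , d≉b , d≉c , inj₂ (inj₁ pendant) =
    ⊥-elim (¬Triangle-pendant triangle (to-Pendant d≉a d≉b d≉c pendant))
  ...   | d , d≉a , d≉b , d≉c , inj₂ (inj₂ (inj₁ pendant)) =
    ⊥-elim (¬Triangle-pendant (Triangle-swap triangle) (to-Pendant d≉b d≉a d≉c pendant))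
  ...   | d , d≉a , d≉b , d≉c , inj₂ (inj₂ (inj₂ pendant)) =
    ⊥-elim (¬Triangle-pendant (Triangle-rotate (Triangle-rotate triangle))
                              (to-Pendant d≉c d≉a d≉b pendant))

module InducedPermutation {n : ℕ} (S : Subset n) (trh : ∀ s → s ∈ S → IsTransposition s)
                          (gens : GeneratesSym S) (4<n : 4 < n)
                          (φ : LVertex S ↔ LVertex S) (φ-aut : IsLAut S φ) where

  open TranspositionGraph S
  open Connected trh gens
  open LineGraph S trh
  open LineGraphAutomorphism S trh φ φ-aut
  module φ⁻¹ = LineGraphAutomorphism S trh (↔-sym φ) (IsLAut-sym φ φ-aut)
  open Inverse φ using (to; from; strictlyInverseʳ)

  2<n : 2 < n
  2<n = <⇒≤ (<⇒≤ 4<n)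

  image : ∀ {x y} → TAdj S x y → LVertex S
  image xy = to (edge xy)

  image-irrelevant : ∀ {x y z} (xy xy′ : TAdj S x y) → image xy ∋ z → image xy′ ∋ z
  image-irrelevant {z = z} xy xy′ = subst (λ a → to a ∋ z) (edge-irrelevant xy xy′)

  images-meet : ∀ {x u v} (xu : TAdj S x u) (xv : TAdj S x v) → u ≢ v → Meet (image xu) (image xv)
  images-meet {x} xu xv u≢v = to-Meet (edge-≉ xu xv u≢v) (x , edge-∋ˡ xu , edge-∋ˡ xv)

  centre : ∀ {x} → Branching x → Fin n
  centre (_ , _ , u≢v , xu , xv) = proj₁ (images-meet xu xv u≢v)

  centre-unique : ∀ {x z} (bx : Branching x) → (∀ {y} (xy : TAdj S x y) → image xy ∋ z) → z ≡ centre bx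
  centre-unique (_ , _ , u≢v , xu , xv) through-z =
    meet-unique (to-≉ (edge-≉ xu xv u≢v)) (through-z xu) (through-z xv)
      (proj₁ (proj₂ (images-meet xu xv u≢v))) (proj₂ (proj₂ (images-meet xu xv u≢v)))

  centre-∋ : ∀ {x y} (bx : Branching x) (xy : TAdj S x y) → image xy ∋ centre bx
  centre-∋ {y = y} (u , v , u≢v , xu , xv) xy with y ≟ u | y ≟ v
  ... | yes refl | _        = image-irrelevant xu xy (proj₁ (proj₂ (images-meet xu xv u≢v)))
  ... | no _     | yes refl = image-irrelevant xv xy (proj₂ (proj₂ (images-meet xu xv u≢v)))
  ... | no y≢u   | no y≢v   with star-preserved gens 4<n (edge-≉ xu xv u≢v) (edge-≉ xu xy (y≢u ∘ sym))
                                 (edge-≉ xv xy (y≢v ∘ sym)) (edge-∋ˡ xu) (edge-∋ˡ xv) (edge-∋ˡ xy)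
  ...   | w , uw , vw , yw =
    subst (image xy ∋_) (meet-unique (to-≉ (edge-≉ xu xv u≢v)) uw vw u∋c v∋c) yw
    where
    u∋c = proj₁ (proj₂ (images-meet xu xv u≢v))
    v∋c = proj₂ (proj₂ (images-meet xu xv u≢v))

  π : Fin n → Fin n
  π x with branching-or-adjacent 2<n x
  ... | inj₁ bx                  = centre bx
  ... | inj₂ (_ , _ , xu , bu)   = app (proj₁ (image xu)) (centre bu)

  π-∋ : ∀ {x y} (xy : TAdj S x y) → image xy ∋ π x
  π-∋ {x} xy with branching-or-adjacent 2<n x
  ... | inj₁ bx = centre-∋ bx xy
  ... | inj₂ (¬bx , _ , xu , bu) with ¬Branching-neighbour-unique ¬bx xu xy
  ...   | refl = image-irrelevant xu xy (∋-app (centre-∋ bu (TAdj-sym xu)))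

  π-centre : ∀ {x} (bx : Branching x) → π x ≡ centre bx
  π-centre bx = centre-unique bx π-∋

  π-≢-unbranched : ∀ {x y} → TAdj S x y → ¬ Branching x → π x ≢ π y
  π-≢-unbranched {x} xy ¬bx with branching-or-adjacent 2<n x
  ... | inj₁ bx = ⊥-elim (¬bx bx)
  ... | inj₂ (_ , _ , xu , bu) with ¬Branching-neighbour-unique ¬bx xu xy
  ...   | refl = λ πx≡πu → app-≢ (centre-∋ bu (TAdj-sym xu)) (trans πx≡πu (π-centre bu))

  -- With a ≢ y and b ≢ x, the edges xa and yb either close a triangle x a y (a ≡ b), whose image
  -- would be a star at π x, or are disjoint, while their images would meet at π x.
  π-≢-branching : ∀ {x y} → Branching x → Branching y → TAdj S x y → π x ≢ π y
  π-≢-branching {x} {y} bx by xy πx≡πy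
    with other-neighbour bx y | other-neighbour by x
  ... | a , a≢y , xa | b , b≢x , yb with a ≟ b
  ...   | yes refl = ¬CommonPoint-triangle xy xa ya (back (φ⁻¹.star-preserved gens 4<n
            (to-≉ xy≉xa) (to-≉ xy≉ya) (to-≉ xa≉ya) (π-∋ xy) (π-∋ xa) ya∋πx))
    where
    ya = yb
    ya∋πx = subst (image ya ∋_) (sym πx≡πy) (π-∋ ya)
    x∉ya = [ TAdj-irrefl xy , TAdj-irrefl xa ]
    xy≉xa = edge-≉ xy xa (a≢y ∘ sym)
    xy≉ya = ≉-by (edge-∋ˡ xy) (x∉ya ∘ edge-oneOf ya)
    xa≉ya = ≉-by (edge-∋ˡ xa) (x∉ya ∘ edge-oneOf ya)
    back : CommonPoint (from (image xy)) (from (image xa)) (from (image ya)) →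
           CommonPoint (edge xy) (edge xa) (edge ya)
    back (w , p , q , r) = w , subst (_∋ w) (strictlyInverseʳ (edge xy)) p ,
      subst (_∋ w) (strictlyInverseʳ (edge xa)) q , subst (_∋ w) (strictlyInverseʳ (edge ya)) r
  ...   | no a≢b = edges-disjoint xa yb x∉yb [ a≢y , a≢b ]
            (from-Meet (≉-by (edge-∋ˡ xa) (x∉yb ∘ edge-oneOf yb))
              (π x , π-∋ xa , subst (image yb ∋_) (sym πx≡πy) (π-∋ yb)))
    where
    x∉yb = [ TAdj-irrefl xy , b≢x ∘ sym ]

  π-≢ : ∀ {x y} → TAdj S x y → π x ≢ π y
  π-≢ {x} {y} xy = by-cases (branching? x) (branching? y)
    where
    by-cases : Dec (Branching x) → Dec (Branching y) → π x ≢ π y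
    by-cases (yes bx) (yes by) = π-≢-branching bx by xy
    by-cases (yes _)  (no ¬by) = π-≢-unbranched (TAdj-sym xy) ¬by ∘ sym
    by-cases (no ¬bx) _        = π-≢-unbranched xy ¬bx

  π-induces : Induces φ π
  π-induces (s , s∈S) t = Endpoint-pair {s = proj₁ (image xy)}
    (_∋_.isEndpoint (π-∋ xy)) (_∋_.isEndpoint (π-∋ (TAdj-sym xy))) (π-≢ xy)
    where
    xy = s , s∈S , t

mainTheorem5 : (n : ℕ) → 5 ≤ n → (S : Subset n) →
    (∀ s → s ∈ S → IsTransposition s) → GeneratesSym S →
    (φ : LVertex S ↔ LVertex S) → IsLAut S φ →
    ∃[ g ] (IsCayAut S g × Inverse.to g e ≡ e ×
      (∀ (a : LVertex S) → Inverse.to g (proj₁ a) ≡ proj₁ (Inverse.to φ a)))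
mainTheorem5 n 5≤n S trh gens φ φ-aut =
    conjugation ρ
  , automorphism-isCayAut S (conjugation ρ) (conjugate-· ρ)
      (conjugate-∈ ρ φ Φ.π-induces) (conjugate-∈ (↔-sym ρ) (↔-sym φ) Φ⁻¹.π-induces)
  , conjugate-e ρ
  , conjugate-restricts ρ φ Φ.π-induces
  where
  open LineGraph S trh
  module Φ   = InducedPermutation S trh gens 5≤n φ φ-aut
  module Φ⁻¹ = InducedPermutation S trh gens 5≤n (↔-sym φ) (IsLAut-sym φ φ-aut)
  2<n : 2 < n
  2<n = <⇒≤ (<⇒≤ 5≤n)
  ρ : Fin n ↔ Fin n
  ρ = mk↔ₛ′ Φ.π Φ⁻¹.π
        (InducedInverse.ψ∘π≡id (↔-sym φ) Φ⁻¹.π-induces Φ.π-induces gens 2<n)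
        (InducedInverse.ψ∘π≡id φ Φ.π-induces Φ⁻¹.π-induces gens 2<n)
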